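{- Given an OP word $w=\langle U,M,P\rangle$ and the tree $T_w=\tau(w)$, the function $\tau$ is an isomorphism between the positions of $w$ and the nodes of $T_w$; that is, the rules defining $\tau$ assign to every position of $w$ exactly one node, and $\tau$ is a bijection from $U$ onto the node set of $T_w$.
   Context: Let $AP$ be a finite set of atomic propositions partitioned into normal propositions and structural labels, $\#\notin AP$ an end marker, $\Sigma=2^{AP}$. An operator precedence matrix (OPM) $M$ on $\Sigma$ is a partial function $M:(\Sigma\cup\{\#\})^2\to\{\lessdot,\doteq,\gtrdot\}$, defined only on sets containing exactly one structural label, depending only on the structural labels of its arguments. Write $a\,\pi\,b$ for $M(a,b)=\pi$; by convention $\#\lessdot b$ for every $b$ (including $\#$) and $a\gtrdot\#$ for every $a\in\Sigma$. A simple chain is a string $c_0c_1\dots c_\ell c_{\ell+1}$ with $\ell\ge1$, $c_0,c_{\ell+1}\in\Sigma\cup\{\#\}$, $c_1,\dots,c_\ell\in\Sigma$, $c_0\lessdot c_1\doteq\dots\doteq c_\ell\gtrdot c_{\ell+1}$. A composed chain is $c_0s_0c_1s_1\dots c_\ell s_\ell c_{\ell+1}$ with $c_0c_1\dots c_{\ell+1}$ a simple chain and each $s_k$ empty or such that $c_ks_kc_{k+1}$ is a chain. A word $x\in\Sigma^*$ is compatible with $M$ if $M$ is defined on consecutive letters and on the context $(a,b)$ of every chain substring of $\#x\#$. An OP word is $w=\langle U,M,P\rangle$, $U=\{0,\dots,n+1\}$, $P(0)=P(n+1)=\#$, $P(1)\cdots P(n)$ compatible with $M$; $i\,\pi\,j$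 means $P(i)\,\pi\,P(j)$; $\chi(i,j)$ holds iff $i<j-1$ and $P(i)\cdots P(j)$ is a chain. Unranked ordered trees have as nodes finite sequences of natural numbers (prefix-closed, with $s\cdot k$ present, $k>0$, implying $s\cdot(k-1)$ present); the children of $s$ are the $s\cdot k$, ordered by $k$. The map $\tau$: $\tau(0)=0$ (the root); for every position $i$: if $i\lessdot i+1$ or $i\doteq i+1$ then $\tau(i+1)=\tau(i)\cdot0$; and if $j_1<\dots<j_n$ are all positions $j$ with $\chi(i,j)$ and ($i\lessdot j$ or $i\doteq j$), then $\tau(j_k)=\tau(i)\cdot k$. $T_w$ is the tree with node set $\{\tau(i):i\in U\}$ and labels $L_w(\tau(i))=P(i)$. -}

module Defs where

open import Data.Nat using (ℕ; zero; suc; _+_; _∸_; _≤_; _<_; _<?_)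
open import Data.Fin using (Fin; fromℕ<)
open import Data.Bool using (Bool; true)
open import Data.Maybe using (Maybe; just)
open import Data.List using (List; []; _∷_; _++_; map; upTo)
open import Data.Product using (Σ; ∃; _×_)
open import Data.Sum using (_⊎_)
open import Relation.Nullary using (¬_; yes; no)
open import Relation.Binary.PropositionalEquality using (_≡_)

data Prec : Set where
  ⋖ ≐ ⋗ : Prec

-- Atomic propositions AP = Fin m; a letter of Σ = 2^AP is a subset of AP.
Letter : ℕ → Set
Letter m = Fin m → Bool

data Ext (m : ℕ) : Set where
  #   : Ext m
  ⟨_⟩ : Letter m → Ext m

-- An OPM over AP = Fin m.  'isStruct' gives the partition of AP into
-- structural labels (true) and normal propositions (false).  Since the
-- matrix is defined only on letters containing exactly one structural label
-- and depends only on those labels, it is given by a partial table 'rel'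
-- on (structural) labels.
record OPM (m : ℕ) : Set where
  field
    isStruct : Fin m → Bool
    rel      : Fin m → Fin m → Maybe Prec

module _ {m : ℕ} (M : OPM m) where
  open OPM M

  UniqueStruct : Letter m → Fin m → Set
  UniqueStruct a l =
    isStruct l ≡ true × a l ≡ true ×
    (∀ l′ → isStruct l′ ≡ true → a l′ ≡ true → l′ ≡ l)

  data PrecR : Ext m → Ext m → Prec → Set where
    #⋖    : ∀ {b} → PrecR # b ⋖
    ⋗#    : ∀ {a} → PrecR ⟨ a ⟩ # ⋗
    byRel : ∀ {a b l l′ π} → UniqueStruct a l → UniqueStruct b l′ →
            rel l l′ ≡ just π → PrecR ⟨ a ⟩ ⟨ b ⟩ π

  Defined : Ext m → Ext m → Set
  Defined a b = ∃ λ π → PrecR a b π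

  -- A chain is
  --   c₀ s₀ c₁ s₁ … c_ℓ s_ℓ c_{ℓ+1}
  -- with c₀ ⋖ c₁ ≐ … ≐ c_ℓ ⋗ c_{ℓ+1}, ℓ ≥ 1, c₁…c_ℓ ∈ Σ, and each s_k
  -- empty or such that c_k s_k c_{k+1} is a chain ('Gap').
  -- 'Rest c r' : c = c_k (k ≥ 1) and r = s_k c_{k+1} … s_ℓ c_{ℓ+1}.
  data Chain : List (Ext m) → Set
  data Gap : Ext m → List (Ext m) → Ext m → Set
  data Rest : Ext m → List (Ext m) → Set

  data Gap where
    empty  : ∀ {c d} → Gap c [] d
    nested : ∀ {c s d} → Chain (c ∷ s ++ d ∷ []) → Gap c s d

  data Rest where
    stop : ∀ {c s d} → Gap c s d → PrecR c d ⋗ → Rest c (s ++ d ∷ [])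
    step : ∀ {c s a r} → Gap c s ⟨ a ⟩ → PrecR c ⟨ a ⟩ ≐ →
           Rest ⟨ a ⟩ r → Rest c (s ++ ⟨ a ⟩ ∷ r)

  data Chain where
    mk : ∀ {c₀ s a r} → PrecR c₀ ⟨ a ⟩ ⋖ → Gap c₀ s ⟨ a ⟩ →
         Rest ⟨ a ⟩ r → Chain (c₀ ∷ s ++ ⟨ a ⟩ ∷ r)

  -- An OP word of length n over M: the letters x, positions U = {0,…,n+1}
  -- (as naturals i ≤ n+1) and labelling P with P(0) = P(n+1) = #.
  module Word (n : ℕ) (x : Fin n → Letter m) where

    P : ℕ → Ext m
    P zero = #
    P (suc k) with k <? n
    ... | yes p = ⟨ x (fromℕ< p) ⟩
    ... | no _  = #

    range : ℕ → ℕ → List ℕ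
    range i j = map (i +_) (upTo (suc (j ∸ i)))

    sub : ℕ → ℕ → List (Ext m)
    sub i j = map P (range i j)

    Compatible : Set
    Compatible =
      (∀ i → 1 ≤ i → suc i ≤ n → Defined (P i) (P (suc i))) ×
      (∀ i j → i ≤ j → j ≤ suc n → Chain (sub i j) → Defined (P i) (P j))

    _⟪_⟫_ : ℕ → Prec → ℕ → Set
    i ⟪ π ⟫ j = PrecR (P i) (P j) π

    χ : ℕ → ℕ → Set
    χ i j = suc i < j × j ≤ suc n × Chain (sub i j)

    -- j is one of the positions j₁ < … < j_n of the chain rule for i
    IsChild : ℕ → ℕ → Set
    IsChild i j = χ i j × (i ⟪ ⋖ ⟫ j ⊎ i ⟪ ≐ ⟫ j)

    -- Rank i j k : j = j_k in the increasing enumeration j₁ < j₂ < … of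
    -- the positions j with IsChild i j.
    data Rank (i : ℕ) : ℕ → ℕ → Set where
      first : ∀ {j} → IsChild i j →
              (∀ j′ → j′ < j → ¬ IsChild i j′) → Rank i j 1
      next  : ∀ {j′ j k} → IsChild i j → j′ < j → Rank i j′ k →
              (∀ j″ → j′ < j″ → j″ < j → ¬ IsChild i j″) →
              Rank i j (suc k)

    -- Nodes are finite sequences of naturals; s · k is s ++ [k].
    -- Tau i s : the rules defining τ assign node s to position i.
    data Tau : ℕ → List ℕ → Set where
      root  : Tau 0 (0 ∷ [])
      succ  : ∀ {i s} → Tau i s → suc i ≤ suc n →
              (i ⟪ ⋖ ⟫ suc i ⊎ i ⟪ ≐ ⟫ suc i) →
              Tau (suc i) (s ++ 0 ∷ [])
      child : ∀ {i j k s} → Tau i s → j ≤ suc n → Rank i j k →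
              Tau j (s ++ k ∷ [])

    Node : List ℕ → Set
    Node s = ∃ λ i → i ≤ suc n × Tau i s

module Submission where

-- Call u a PARENT of a position y when u ⋖ y or u ≐ y and either y = u + 1
-- or χ(u, y).  The two rules defining τ say exactly that τ(y) is a child of
-- τ(u) for a parent u of y: the 0-th child if y = u + 1, the k-th if y is
-- the k-th position j with χ(u, j) and u ⋖ j or u ≐ j.

open import Defs
open import Data.Nat using (ℕ; zero; suc; _+_; _∸_; _≤_; _<_; _<?_; _≤?_; z≤n; s≤s; _≟_)
open import Data.Nat.Properties
open import Data.Nat.Induction using (<-rec)
open import Data.Fin using (Fin)
import Data.Fin.Properties as Fin
open import Data.Bool using (true)
import Data.Bool as Bool
open import Data.Maybe using (Maybe; just; nothing)
open import Data.Maybe.Properties using (just-injective)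
open import Data.List using (List; []; _∷_; _++_; map; upTo; applyUpTo)
open import Data.List.Properties using (∷ʳ-injectiveˡ; ∷ʳ-injectiveʳ; ∷-injective; ++-conicalʳ; map-applyUpTo)
open import Data.Product using (Σ; ∃; _×_; _,_; proj₁; proj₂)
open import Data.Sum using (_⊎_; inj₁; inj₂; [_,_]′)
open import Data.Empty using (⊥; ⊥-elim)
open import Relation.Nullary using (¬_; Dec; yes; no)
open import Relation.Nullary.Decidable using (_×-dec_; _⊎-dec_; _→-dec_; map′)
open import Relation.Binary.PropositionalEquality
open import Relation.Binary.Definitions using (tri<; tri≈; tri>)

module Segments {a} {A : Set a} (f : ℕ → A) where

  run : ℕ → ℕ → List A
  run i zero    = []
  run i (suc k) = f (suc i) ∷ run (suc i) k

  upto inside : ℕ → ℕ → List A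
  upto   i j = run i (j ∸ i)
  inside i j = run i (j ∸ suc i)

  run-applyUpTo : ∀ (g : ℕ → ℕ) i k → (∀ t → g t ≡ suc (i + t)) →
                  map f (applyUpTo g k) ≡ run i k
  run-applyUpTo g i zero    g≗ = refl
  run-applyUpTo g i (suc k) g≗ =
    cong₂ _∷_ (cong f (trans (g≗ 0) (cong suc (+-identityʳ i))))
              (run-applyUpTo (λ t → g (suc t)) (suc i) k
                 (λ t → trans (g≗ (suc t)) (cong suc (+-suc i t))))

  map-range : ∀ i k → map f (map (i +_) (upTo (suc k))) ≡ f i ∷ run i k
  map-range i k =
    cong₂ _∷_ (cong f (+-identityʳ i))
      (trans (cong (map f) (map-applyUpTo suc (i +_) k)) (run-applyUpTo _ i k (+-suc i)))

  run-++ : ∀ i a b → run i (a + suc b) ≡ run i a ++ f (suc (i + a)) ∷ run (suc (i + a)) b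
  run-++ i zero    b rewrite +-identityʳ i = refl
  run-++ i (suc a) b rewrite +-suc i a = cong (f (suc i) ∷_) (run-++ (suc i) a b)

  run-empty : ∀ {i k} → run i k ≡ [] → k ≡ 0
  run-empty {k = zero} _ = refl

  run-cut : ∀ i k s y r → run i k ≡ s ++ y ∷ r →
    Σ ℕ λ a → Σ ℕ λ b → k ≡ a + suc b × s ≡ run i a × y ≡ f (suc (i + a)) ×
                        r ≡ run (suc (i + a)) b
  run-cut i zero    []      y r ()
  run-cut i zero    (_ ∷ _) y r ()
  run-cut i (suc k) [] y r eq with ∷-injective eq
  ... | refl , refl =
    0 , k , refl , refl , cong (λ z → f (suc z)) (sym (+-identityʳ i)) ,
    cong (λ z → run (suc z) k) (sym (+-identityʳ i))
  run-cut i (suc k) (z ∷ s) y r eq with ∷-injective eq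
  ... | refl , eq′ with run-cut (suc i) k s y r eq′
  ... | a , b , refl , refl , refl , refl =
    suc a , b , refl , refl , cong (λ z → f (suc z)) (sym (+-suc i a)) ,
    cong (λ z → run (suc z) b) (sym (+-suc i a))

  upto-self : ∀ p → upto p p ≡ []
  upto-self p rewrite n∸n≡0 p = refl

  upto-split : ∀ {i p j} → i < p → p ≤ j → upto i j ≡ inside i p ++ f p ∷ upto p j
  upto-split {i} ip pj with m≤n⇒∃[o]m+o≡n ip | m≤n⇒∃[o]m+o≡n pj
  ... | a , refl | b , refl
    rewrite m+n∸m≡n (suc i) a | m+n∸m≡n (suc i + a) b
          | sym (+-suc (i + a) b) | +-assoc i a (suc b) | m+n∸m≡n i (a + suc b)
    = run-++ i a b

  upto-last : ∀ {i j} → i < j → upto i j ≡ inside i j ++ f j ∷ []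
  upto-last {i} {j} ij = trans (upto-split ij ≤-refl) (cong (λ L → inside i j ++ f j ∷ L) (upto-self j))

  upto-cut : ∀ {i j s y r} → i ≤ j → upto i j ≡ s ++ y ∷ r →
    Σ ℕ λ p → i < p × p ≤ j × s ≡ inside i p × y ≡ f p × r ≡ upto p j
  upto-cut {i} {j} {s} {y} {r} ij eq with run-cut i (j ∸ i) s y r eq
  ... | a , b , k≡ , refl , refl , refl =
    suc (i + a) , s≤s (m≤m+n i a) , subst (suc (i + a) ≤_) (sym j≡) (m≤m+n (suc (i + a)) b) ,
    cong (run i) (sym (m+n∸m≡n (suc i) a)) , refl ,
    cong (run (suc (i + a))) (trans (sym (m+n∸m≡n (suc (i + a)) b)) (cong (_∸ suc (i + a)) (sym j≡)))
    where
    j≡ : j ≡ suc (i + a) + b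
    j≡ = begin
      j                 ≡⟨ sym (m+[n∸m]≡n ij) ⟩
      i + (j ∸ i)       ≡⟨ cong (i +_) k≡ ⟩
      i + (a + suc b)   ≡⟨ sym (+-assoc i a (suc b)) ⟩
      i + a + suc b     ≡⟨ +-suc (i + a) b ⟩
      suc (i + a) + b   ∎
      where open ≡-Reasoning

module Precedence {m} (M : OPM m) where
  open OPM M

  struct-unique : ∀ {a l l′} → UniqueStruct M a l → UniqueStruct M a l′ → l ≡ l′
  struct-unique (str , mem , _) (_ , _ , only) = only _ str mem

  prec-functional : ∀ {a b π π′} → PrecR M a b π → PrecR M a b π′ → π ≡ π′
  prec-functional #⋖ #⋖ = refl
  prec-functional ⋗# ⋗# = refl
  prec-functional (byRel u₁ v₁ e₁) (byRel u₂ v₂ e₂)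
    with struct-unique u₁ u₂ | struct-unique v₁ v₂
  ... | refl | refl = just-injective (trans (sym e₁) e₂)

  ⋖-not-≐ : ∀ {a b} → PrecR M a b ⋖ → ¬ PrecR M a b ≐
  ⋖-not-≐ p q with prec-functional p q
  ... | ()

  ⋖-not-⋗ : ∀ {a b} → PrecR M a b ⋖ → ¬ PrecR M a b ⋗
  ⋖-not-⋗ p q with prec-functional p q
  ... | ()

  ≐-not-⋗ : ∀ {a b} → PrecR M a b ≐ → ¬ PrecR M a b ⋗
  ≐-not-⋗ p q with prec-functional p q
  ... | ()

  _≟ᵖ_ : ∀ (π π′ : Prec) → Dec (π ≡ π′)
  ⋖ ≟ᵖ ⋖ = yes refl
  ≐ ≟ᵖ ≐ = yes refl
  ⋗ ≟ᵖ ⋗ = yes refl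
  ⋖ ≟ᵖ ≐ = no λ ()
  ⋖ ≟ᵖ ⋗ = no λ ()
  ≐ ≟ᵖ ⋖ = no λ ()
  ≐ ≟ᵖ ⋗ = no λ ()
  ⋗ ≟ᵖ ⋖ = no λ ()
  ⋗ ≟ᵖ ≐ = no λ ()

  rel-is? : ∀ (entry : Maybe Prec) π → Dec (entry ≡ just π)
  rel-is? nothing  π = no λ ()
  rel-is? (just π′) π = map′ (cong just) just-injective (π′ ≟ᵖ π)

  uniqueStruct? : ∀ a l → Dec (UniqueStruct M a l)
  uniqueStruct? a l =
    (isStruct l Bool.≟ true) ×-dec (a l Bool.≟ true) ×-dec
    Fin.all? (λ l′ → (isStruct l′ Bool.≟ true) →-dec ((a l′ Bool.≟ true) →-dec (l′ Fin.≟ l)))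

  prec? : ∀ a b π → Dec (PrecR M a b π)
  prec? #     b     ⋖ = yes #⋖
  prec? #     b     ≐ = no λ ()
  prec? #     b     ⋗ = no λ ()
  prec? ⟨ a ⟩ #     ⋖ = no λ ()
  prec? ⟨ a ⟩ #     ≐ = no λ ()
  prec? ⟨ a ⟩ #     ⋗ = yes ⋗#
  prec? ⟨ a ⟩ ⟨ b ⟩ π with Fin.any? (uniqueStruct? a) | Fin.any? (uniqueStruct? b)
  ... | no ¬la | _ = no λ { (byRel u _ _) → ¬la (_ , u) }
  ... | yes _ | no ¬lb = no λ { (byRel _ v _) → ¬lb (_ , v) }
  ... | yes (l , ul) | yes (l′ , ul′) with rel-is? (rel l l′) π
  ...   | yes e = yes (byRel ul ul′ e)
  ...   | no ¬e = no λ { (byRel u v e) →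
            ¬e (subst₂ (λ p q → rel p q ≡ just π) (struct-unique u ul) (struct-unique v ul′) e) }

search-between : ∀ {Q : ℕ → Set} lo hi → (∀ p → lo < p → p < hi → Dec (Q p)) →
                 Dec (∃ λ p → lo < p × p < hi × Q p)
search-between {Q} lo hi Q? =
  map′ (λ (p , _ , found) → p , found) (λ (p , found) → p , proj₁ (proj₂ found) , found)
       (anyUpTo? inRange? hi)
  where
  inRange? : ∀ p → Dec (lo < p × p < hi × Q p)
  inRange? p with lo <? p | p <? hi
  ... | no ¬lo<p | _        = no (λ z → ¬lo<p (proj₁ z))
  ... | yes _    | no ¬p<hi = no (λ z → ¬p<hi (proj₁ (proj₂ z)))
  ... | yes lo<p | yes p<hi = map′ (λ q → lo<p , p<hi , q) (λ z → proj₂ (proj₂ z)) (Q? p lo<p p<hi)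

module Positions {m} (M : OPM m) (n : ℕ) (x : Fin n → Letter m) where
  open Word M n x
  open Precedence M
  open Segments P

  P-letter : ∀ p → 1 ≤ p → p ≤ n → ∃ λ a → P p ≡ ⟨ a ⟩
  P-letter (suc k) _ k<n with k <? n
  ... | yes _   = _ , refl
  ... | no ¬k<n = ⊥-elim (¬k<n k<n)

  P-end : P (suc n) ≡ #
  P-end with n <? n
  ... | yes n<n = ⊥-elim (<-irrefl refl n<n)
  ... | no _    = refl

  sub-≡ : ∀ i j → sub i j ≡ P i ∷ upto i j
  sub-≡ i j = map-range i (j ∸ i)

  -- Chains on positions: ChainAt i j says that P(i) ⋯ P(j) is a chain,
  -- GapAt i j that P(i) ⋯ P(j) is a gap c s d (j = i+1 or a nested chain),
  -- RestAt p j that P(p) ⋯ P(j) has the shape c s c′ … s′ d of Defs.Rest.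
  data ChainAt : ℕ → ℕ → Set
  data GapAt   : ℕ → ℕ → Set
  data RestAt  : ℕ → ℕ → Set

  data GapAt where
    adjacent : ∀ {i} → GapAt i (suc i)
    nestedAt : ∀ {i j} → ChainAt i j → GapAt i j

  data RestAt where
    stopAt : ∀ {p j} → GapAt p j → p ⟪ ⋗ ⟫ j → RestAt p j
    stepAt : ∀ {p q j} → GapAt p q → p ⟪ ≐ ⟫ q → RestAt q j → RestAt p j

  data ChainAt where
    chainAt : ∀ {i p j} → i ⟪ ⋖ ⟫ p → GapAt i p → RestAt p j → ChainAt i j

  gapAt-< : ∀ {i j} → GapAt i j → i < j
  restAt-< : ∀ {i j} → RestAt i j → i < j
  chainAt-< : ∀ {i j} → ChainAt i j → suc i < j
  gapAt-< adjacent = ≤-refl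
  gapAt-< (nestedAt c) = <⇒≤ (chainAt-< c)
  restAt-< (stopAt g _) = gapAt-< g
  restAt-< (stepAt g _ r) = <-trans (gapAt-< g) (restAt-< r)
  chainAt-< (chainAt _ g r) = ≤-<-trans (gapAt-< g) (restAt-< r)

  -- Chain and Rest require the inner symbols c₁ … c_ℓ to be letters.
  letter-inside : ∀ {i p j} → i < p → p < j → j ≤ suc n → ∃ λ a → P p ≡ ⟨ a ⟩
  letter-inside {p = p} ip pj jn = P-letter p (≤-trans (s≤s z≤n) ip) (≤-pred (<-≤-trans pj jn))

  mk′ : ∀ {c₀ s r e} → (∃ λ a → e ≡ ⟨ a ⟩) → PrecR M c₀ e ⋖ → Gap M c₀ s e → Rest M e r →
        Chain M (c₀ ∷ s ++ e ∷ r)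
  mk′ (_ , refl) = mk

  step′ : ∀ {c s r e} → (∃ λ a → e ≡ ⟨ a ⟩) → Gap M c s e → PrecR M c e ≐ → Rest M e r →
          Rest M c (s ++ e ∷ r)
  step′ (_ , refl) = step

  chainAt⇒chain : ∀ {i j} → ChainAt i j → j ≤ suc n → Chain M (P i ∷ upto i j)
  gapAt⇒gap     : ∀ {i j} → GapAt i j → j ≤ suc n → Gap M (P i) (inside i j) (P j)
  restAt⇒rest   : ∀ {p j} → RestAt p j → j ≤ suc n → Rest M (P p) (upto p j)
  chainAt⇒chain {i} (chainAt lt g r) jn =
    subst (λ L → Chain M (P i ∷ L)) (sym (upto-split (gapAt-< g) (<⇒≤ (restAt-< r))))
      (mk′ (letter-inside (gapAt-< g) (restAt-< r) jn) lt
           (gapAt⇒gap g (≤-trans (<⇒≤ (restAt-< r)) jn)) (restAt⇒rest r jn))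
  gapAt⇒gap {i} adjacent _ =
    subst (λ s → Gap M (P i) s (P (suc i))) (cong (run i) (sym (n∸n≡0 i))) empty
  gapAt⇒gap {i} (nestedAt c) jn =
    nested (subst (λ L → Chain M (P i ∷ L)) (upto-last (<⇒≤ (chainAt-< c))) (chainAt⇒chain c jn))
  restAt⇒rest {p} (stopAt g gt) jn =
    subst (Rest M (P p)) (sym (upto-last (gapAt-< g))) (stop (gapAt⇒gap g jn) gt)
  restAt⇒rest {p} (stepAt g eq r) jn =
    subst (Rest M (P p)) (sym (upto-split (gapAt-< g) (<⇒≤ (restAt-< r))))
      (step′ (letter-inside (gapAt-< g) (restAt-< r) jn)
             (gapAt⇒gap g (≤-trans (<⇒≤ (restAt-< r)) jn)) eq (restAt⇒rest r jn))

  chain⇒chainAt : ∀ {L i j} → Chain M L → i ≤ j → L ≡ P i ∷ upto i j → ChainAt i j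
  gap⇒gapAt     : ∀ {c s d i j} → Gap M c s d → i < j →
                  c ≡ P i → s ≡ inside i j → d ≡ P j → GapAt i j
  rest⇒restAt   : ∀ {c r p j} → Rest M c r → p ≤ j → c ≡ P p → r ≡ upto p j → RestAt p j
  chain⇒chainAt (mk lt g r) ij eq with ∷-injective eq
  ... | c≡ , eq′ with upto-cut ij (sym eq′)
  ... | p , ip , pj , s≡ , a≡ , r≡ =
    chainAt (subst₂ (λ u v → PrecR M u v ⋖) c≡ a≡ lt) (gap⇒gapAt g ip c≡ s≡ a≡) (rest⇒restAt r pj a≡ r≡)
  gap⇒gapAt {i = i} empty ij _ s≡ _ =
    subst (GapAt i) (≤-antisym ij (m∸n≡0⇒m≤n (run-empty (sym s≡)))) adjacent
  gap⇒gapAt (nested c) ij c≡ s≡ d≡ =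
    nestedAt (chain⇒chainAt c (<⇒≤ ij)
      (cong₂ _∷_ c≡ (trans (cong₂ (λ u v → u ++ v ∷ []) s≡ d≡) (sym (upto-last ij)))))
  rest⇒restAt (stop g gt) pj c≡ r≡ with upto-cut pj (sym r≡)
  ... | q , pq , qj , s≡ , d≡ , rest≡ with ≤-antisym qj (m∸n≡0⇒m≤n (run-empty (sym rest≡)))
  ... | refl = stopAt (gap⇒gapAt g pq c≡ s≡ d≡) (subst₂ (λ u v → PrecR M u v ⋗) c≡ d≡ gt)
  rest⇒restAt (step g eq r) pj c≡ r≡ with upto-cut pj (sym r≡)
  ... | q , pq , qj , s≡ , a≡ , rest≡ =
    stepAt (gap⇒gapAt g pq c≡ s≡ a≡) (subst₂ (λ u v → PrecR M u v ≐) c≡ a≡ eq) (rest⇒restAt r qj a≡ rest≡)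

  χ⇒chainAt : ∀ {i j} → χ i j → ChainAt i j
  χ⇒chainAt {i} {j} (i+1<j , _ , c) = chain⇒chainAt c (<⇒≤ (<-trans ≤-refl i+1<j)) (sub-≡ i j)

  chainAt⇒sub : ∀ {i j} → ChainAt i j → j ≤ suc n → Chain M (sub i j)
  chainAt⇒sub {i} {j} c jn = subst (Chain M) (sym (sub-≡ i j)) (chainAt⇒chain c jn)

  -- By determinism of M, gaps never cross, and a position strictly
  -- inside a gap or rest ending at j is followed by j with ⋗.
  inner-takes      : ∀ {a b j} → GapAt a j → GapAt b j → a < b → b ⟪ ⋗ ⟫ j
  inner-takes-rest : ∀ {p b j} → RestAt p j → GapAt b j → p ≤ b → b ⟪ ⋗ ⟫ j
  outer-yields     : ∀ {i x y} → GapAt i x → GapAt i y → x < y → i ⟪ ⋖ ⟫ x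
  no-gap-past-rest : ∀ {i x p y} → GapAt i x → RestAt p y → i < p → p < x → x < y → ⊥
  no-crossing      : ∀ {x y b j} → GapAt x y → GapAt b j → x < b → b < y → y < j → ⊥
  no-crossing-rest : ∀ {p y b j} → RestAt p y → GapAt b j → p ≤ b → b < y → y < j → ⊥

  inner-takes adjacent gb ab = ⊥-elim (<⇒≱ ab (≤-pred (gapAt-< gb)))
  inner-takes (nestedAt (chainAt {p = c} _ g r)) gb ab with <-cmp _ c
  ... | tri< b<c _ _  = ⊥-elim (no-crossing g gb ab b<c (restAt-< r))
  ... | tri≈ _ refl _ = inner-takes-rest r gb ≤-refl
  ... | tri> _ _ c<b  = inner-takes-rest r gb (<⇒≤ c<b)

  inner-takes-rest {p} {b = b} (stopAt g gt) gb pb with <-cmp p b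
  ... | tri< p<b _ _  = inner-takes g gb p<b
  ... | tri≈ _ refl _ = gt
  ... | tri> _ _ b<p  = ⊥-elim (<⇒≱ b<p pb)
  inner-takes-rest {p} {b = b} (stepAt {q = q} g eq r) gb pb with <-cmp b q
  ... | tri≈ _ refl _ = inner-takes-rest r gb ≤-refl
  ... | tri> _ _ q<b  = inner-takes-rest r gb (<⇒≤ q<b)
  ... | tri< b<q _ _ with <-cmp p b
  ...   | tri< p<b _ _  = ⊥-elim (no-crossing g gb p<b b<q (restAt-< r))
  ...   | tri≈ _ refl _ = ⊥-elim (⋖-not-≐ (outer-yields g gb (restAt-< r)) eq)
  ...   | tri> _ _ b<p  = ⊥-elim (<⇒≱ b<p pb)

  outer-yields gx adjacent xy = ⊥-elim (<⇒≱ (gapAt-< gx) (≤-pred xy))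
  outer-yields gx (nestedAt (chainAt {p = c} lt g r)) xy with <-cmp _ c
  ... | tri< x<c _ _  = outer-yields gx g x<c
  ... | tri≈ _ refl _ = lt
  ... | tri> _ _ c<x  = ⊥-elim (no-gap-past-rest gx r (gapAt-< g) c<x xy)

  no-gap-past-rest gx (stopAt g _) ip px xy = no-crossing gx g ip px xy
  no-gap-past-rest {x = x} gx (stepAt {q = q} g eq r) ip px xy with <-cmp x q
  ... | tri< x<q _ _  = no-crossing gx g ip px x<q
  ... | tri≈ _ refl _ = ≐-not-⋗ eq (inner-takes gx g ip)
  ... | tri> _ _ q<x  = no-gap-past-rest gx r (<-trans ip (gapAt-< g)) q<x xy

  no-crossing adjacent _ xb by _ = <⇒≱ xb (≤-pred by)
  no-crossing (nestedAt (chainAt {p = c} _ g r)) gbj xb by yj with <-cmp _ c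
  ... | tri< b<c _ _  = no-crossing g gbj xb b<c (<-trans (restAt-< r) yj)
  ... | tri≈ _ refl _ = no-crossing-rest r gbj ≤-refl by yj
  ... | tri> _ _ c<b  = no-crossing-rest r gbj (<⇒≤ c<b) by yj

  no-crossing-rest {p} {b = b} (stopAt g gt) gbj pb by yj with <-cmp p b
  ... | tri< p<b _ _  = no-crossing g gbj p<b by yj
  ... | tri≈ _ refl _ = ⋖-not-⋗ (outer-yields g gbj yj) gt
  ... | tri> _ _ b<p  = <⇒≱ b<p pb
  no-crossing-rest {p} {b = b} (stepAt {q = q} g eq r) gbj pb by yj with <-cmp b q
  ... | tri≈ _ refl _ = no-crossing-rest r gbj ≤-refl by yj
  ... | tri> _ _ q<b  = no-crossing-rest r gbj (<⇒≤ q<b) by yj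
  ... | tri< b<q _ _ with <-cmp p b
  ...   | tri< p<b _ _  = no-crossing g gbj p<b b<q (<-trans (restAt-< r) yj)
  ...   | tri≈ _ refl _ = ⋖-not-≐ (outer-yields g gbj (<-trans (restAt-< r) yj)) eq
  ...   | tri> _ _ b<p  = <⇒≱ b<p pb

  Yields : ℕ → ℕ → Set
  Yields u y = u ⟪ ⋖ ⟫ y ⊎ u ⟪ ≐ ⟫ y

  Parent : ℕ → ℕ → Set
  Parent u y = GapAt u y × Yields u y

  inner-not-parent : ∀ {a b j} → GapAt a j → Parent b j → a < b → ⊥
  inner-not-parent ga (gb , inj₁ lt) ab = ⋖-not-⋗ lt (inner-takes ga gb ab)
  inner-not-parent ga (gb , inj₂ eq) ab = ≐-not-⋗ eq (inner-takes ga gb ab)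

  -- Decidability of positional chains, by induction on a bound f with
  -- j ≤ i + f; the components of a chain from i to j lie in shorter intervals.
  shrink-left : ∀ {i f p j} → p < j → j ≤ i + suc f → p ≤ i + f
  shrink-left {i} {f} {j = j} pj b = ≤-pred (≤-trans pj (subst (j ≤_) (+-suc i f) b))

  shrink-right : ∀ {i f p j} → i < p → j ≤ i + suc f → j ≤ p + f
  shrink-right {i} {f} {j = j} ip b = ≤-trans (subst (j ≤_) (+-suc i f) b) (+-monoˡ-≤ f ip)

  chainAt? : ∀ f i j → j ≤ i + f → Dec (ChainAt i j)
  gapAt?   : ∀ f i j → j ≤ i + f → Dec (GapAt i j)
  restAt?  : ∀ f p j → j ≤ p + f → Dec (RestAt p j)
  chainAt? zero i j b =
    no λ c → <⇒≱ (<-trans (n<1+n i) (chainAt-< c)) (≤-trans b (≤-reflexive (+-identityʳ i)))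
  chainAt? (suc f) i j b
    with search-between i j (λ p ip pj →
           prec? (P i) (P p) ⋖ ×-dec gapAt? f i p (shrink-left pj b) ×-dec restAt? f p j (shrink-right ip b))
  ... | yes (_ , _ , _ , lt , g , r) = yes (chainAt lt g r)
  ... | no none = no λ { (chainAt lt g r) → none (_ , gapAt-< g , restAt-< r , lt , g , r) }
  gapAt? f i j b with j ≟ suc i
  ... | yes refl = yes adjacent
  ... | no j≢ = map′ nestedAt (λ { adjacent → ⊥-elim (j≢ refl) ; (nestedAt c) → c }) (chainAt? f i j b)
  restAt? zero p j b =
    no λ r → <⇒≱ (restAt-< r) (≤-trans b (≤-reflexive (+-identityʳ p)))
  restAt? (suc f) p j b with gapAt? (suc f) p j b ×-dec prec? (P p) (P j) ⋗
  ... | yes (g , gt) = yes (stopAt g gt)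
  ... | no ¬stop
    with search-between p j (λ q pq qj →
           gapAt? f p q (shrink-left qj b) ×-dec prec? (P p) (P q) ≐ ×-dec restAt? f q j (shrink-right pq b))
  ...   | yes (_ , _ , _ , g , eq , r) = yes (stepAt g eq r)
  ...   | no none = no λ { (stopAt g gt) → ¬stop (g , gt)
                         ; (stepAt g eq r) → none (_ , gapAt-< g , restAt-< r , g , eq , r) }

  isChild? : ∀ i j → Dec (IsChild i j)
  isChild? i j with suc i <? j | j ≤? suc n | prec? (P i) (P j) ⋖ ⊎-dec prec? (P i) (P j) ≐
  ... | no ¬i+1<j | _ | _ = no λ (((i+1<j , _) , _)) → ¬i+1<j i+1<j
  ... | yes _ | no ¬j≤ | _ = no λ (((_ , j≤ , _) , _)) → ¬j≤ j≤
  ... | yes _ | yes _ | no ¬y = no λ ((_ , y)) → ¬y y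
  ... | yes i+1<j | yes j≤ | yes y =
    map′ (λ c → (i+1<j , j≤ , chainAt⇒sub c j≤) , y) (λ ((ch , _)) → χ⇒chainAt ch)
         (chainAt? j i j (m≤n+m j i))

  rank-child : ∀ {i j k} → Rank i j k → IsChild i j
  rank-child (first c _)    = c
  rank-child (next c _ _ _) = c

  rank-positive : ∀ {i j k} → Rank i j k → 1 ≤ k
  rank-positive (first _ _)    = s≤s z≤n
  rank-positive (next _ _ _ _) = s≤s z≤n

  rank-functional : ∀ {i j k k′} → Rank i j k → Rank i j k′ → k ≡ k′
  rank-functional (first _ _) (first _ _) = refl
  rank-functional (first _ none) (next _ a<j ra _) = ⊥-elim (none _ a<j (rank-child ra))
  rank-functional (next _ a<j ra _) (first _ none) = ⊥-elim (none _ a<j (rank-child ra))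
  rank-functional (next {j′ = a} _ a<j ra gap-a) (next {j′ = b} _ b<j rb gap-b) with <-cmp a b
  ... | tri< a<b _ _  = ⊥-elim (gap-a b a<b b<j (rank-child rb))
  ... | tri≈ _ refl _ = cong suc (rank-functional ra rb)
  ... | tri> _ _ b<a  = ⊥-elim (gap-b a b<a a<j (rank-child ra))

  rank-injective : ∀ {i j j′ k} → Rank i j k → Rank i j′ k → j ≡ j′
  rank-injective {j = j} {j′} (first c none) (first c′ none′) with <-cmp j j′
  ... | tri< j<j′ _ _ = ⊥-elim (none′ j j<j′ c)
  ... | tri≈ _ e _    = e
  ... | tri> _ _ j′<j = ⊥-elim (none j′ j′<j c′)
  rank-injective (first _ _) (next _ _ r _) with rank-positive r
  ... | ()
  rank-injective (next _ _ r _) (first _ _) with rank-positive r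
  ... | ()
  rank-injective {j = j} {j′} (next c a<j ra gap) (next c′ b<j′ rb gap′) with rank-injective ra rb
  ... | refl with <-cmp j j′
  ...   | tri< j<j′ _ _ = ⊥-elim (gap′ j a<j j<j′ c)
  ...   | tri≈ _ e _    = e
  ...   | tri> _ _ j′<j = ⊥-elim (gap j′ b<j′ j′<j c′)

  previous-child : ∀ i j →
    (Σ ℕ λ j′ → j′ < j × IsChild i j′ × (∀ j″ → j′ < j″ → j″ < j → ¬ IsChild i j″)) ⊎
    (∀ j′ → j′ < j → ¬ IsChild i j′)
  previous-child i zero = inj₂ λ _ ()
  previous-child i (suc h) with isChild? i h
  ... | yes c = inj₁ (h , n<1+n h , c , λ j″ h<j″ j″<h+1 → ⊥-elim (<⇒≱ h<j″ (≤-pred j″<h+1)))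
  ... | no ¬c with previous-child i h
  ...   | inj₁ (j′ , j′<h , c , none) =
          inj₁ (j′ , m<n⇒m<1+n j′<h , c ,
                λ j″ a b → [ none j″ a , (λ { refl → ¬c }) ]′ (m<1+n⇒m<n∨m≡n b))
  ...   | inj₂ none = inj₂ λ j′ b → [ none j′ , (λ { refl → ¬c }) ]′ (m<1+n⇒m<n∨m≡n b)

  rank-exists : ∀ i j → IsChild i j → ∃ (Rank i j)
  rank-exists i = <-rec (λ j → IsChild i j → ∃ (Rank i j)) rank-of
    where
    rank-of : ∀ j → (∀ {j′} → j′ < j → IsChild i j′ → ∃ (Rank i j′)) → IsChild i j → ∃ (Rank i j)
    rank-of j earlier c with previous-child i j
    ... | inj₂ none = 1 , first c none
    ... | inj₁ (j′ , j′<j , c′ , none) with earlier j′<j c′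
    ...   | k , r = suc k , next c j′<j r none

  τ-bounded : ∀ {i s} → Tau i s → i ≤ suc n
  τ-bounded root          = z≤n
  τ-bounded (succ _ b _)  = b
  τ-bounded (child _ b _) = b

  child-parent : ∀ {i j} → IsChild i j → Parent i j
  child-parent (ch , y) = nestedAt (χ⇒chainAt ch) , y

  parent-unique : ∀ {a b j} → Parent a j → Parent b j → a ≡ b
  parent-unique {a} {b} pa pb with <-cmp a b
  ... | tri< a<b _ _ = ⊥-elim (inner-not-parent (proj₁ pa) pb a<b)
  ... | tri≈ _ a≡b _ = a≡b
  ... | tri> _ _ b<a = ⊥-elim (inner-not-parent (proj₁ pb) pa b<a)

  not-child-of-predecessor : ∀ {i} → ¬ IsChild i (suc i)
  not-child-of-predecessor ((i+1<i+1 , _) , _) = <-irrefl refl i+1<i+1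

  -- the rules never assign two nodes to a position, as its parent is unique
  τ-functional : ∀ {i s s′} → Tau i s → Tau i s′ → s ≡ s′
  τ-functional root root = refl
  τ-functional root (child _ _ r) with rank-child r
  ... | (() , _) , _
  τ-functional (child _ _ r) root with rank-child r
  ... | (() , _) , _
  τ-functional (succ t _ _) (succ t′ _ _) = cong (_++ 0 ∷ []) (τ-functional t t′)
  τ-functional (succ _ _ y) (child _ _ r) with parent-unique (adjacent , y) (child-parent (rank-child r))
  ... | refl = ⊥-elim (not-child-of-predecessor (rank-child r))
  τ-functional (child _ _ r) (succ _ _ y) with parent-unique (adjacent , y) (child-parent (rank-child r))
  ... | refl = ⊥-elim (not-child-of-predecessor (rank-child r))
  τ-functional (child t _ r) (child t′ _ r′)
    with parent-unique (child-parent (rank-child r)) (child-parent (rank-child r′))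
  ... | refl = cong₂ (λ s k → s ++ k ∷ []) (τ-functional t t′) (rank-functional r r′)

  τ-nonempty : ∀ {i s} → Tau i s → s ≡ [] → ⊥
  τ-nonempty root ()
  τ-nonempty (succ {s = s} _ _ _) e with ++-conicalʳ s _ e
  ... | ()
  τ-nonempty (child {s = s} _ _ _) e with ++-conicalʳ s _ e
  ... | ()

  -- a node determines its position: induction on the node, comparing last entries
  τ-injective : ∀ {i j s s′} → Tau i s → Tau j s′ → s ≡ s′ → i ≡ j
  τ-injective root root _ = refl
  τ-injective root (succ {s = s} t _ _)  e = ⊥-elim (τ-nonempty t (sym (∷ʳ-injectiveˡ [] s e)))
  τ-injective root (child {s = s} t _ _) e = ⊥-elim (τ-nonempty t (sym (∷ʳ-injectiveˡ [] s e)))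
  τ-injective (succ {s = s} t _ _)  root e = ⊥-elim (τ-nonempty t (∷ʳ-injectiveˡ s [] e))
  τ-injective (child {s = s} t _ _) root e = ⊥-elim (τ-nonempty t (∷ʳ-injectiveˡ s [] e))
  τ-injective (succ {s = s} t _ _) (succ {s = s′} t′ _ _) e =
    cong suc (τ-injective t t′ (∷ʳ-injectiveˡ s s′ e))
  τ-injective (succ {s = s} _ _ _) (child {s = s′} _ _ r) e with ∷ʳ-injectiveʳ s s′ e | rank-positive r
  ... | refl | ()
  τ-injective (child {s = s} _ _ r) (succ {s = s′} _ _ _) e with ∷ʳ-injectiveʳ s s′ e | rank-positive r
  ... | refl | ()
  τ-injective (child {s = s} t _ r) (child {s = s′} t′ _ r′) e
    with τ-injective t t′ (∷ʳ-injectiveˡ s s′ e) | ∷ʳ-injectiveʳ s s′ e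
  ... | refl | refl = rank-injective r r′

  node-below-parent : ∀ {u y s} → Parent u y → y ≤ suc n → Tau u s → ∃ (Tau y)
  node-below-parent (adjacent , y) b t = _ , succ t b y
  node-below-parent (nestedAt c , y) b t
    with rank-exists _ _ ((chainAt-< c , b , chainAt⇒sub c b) , y)
  ... | _ , r = _ , child t b r

  -- Under compatibility every position y > 0 has a parent, found by an
  -- operator-precedence parse: a stack of open positions, each pushed with
  -- its parent.  On reading y, the top position t is compared with y; while
  -- t ⋗ y it is popped.  Popping a position pushed under ≐ extends the
  -- current rest; popping one pushed under ⋖ closes a chain from its parent
  -- to y, whose endpoints are then related by compatibility.
  module Parsing (compatible : Compatible) where

    data Stack : ℕ → Set where
      bottom : Stack 0
      push   : ∀ {u v} → Stack u → Parent u v → Stack v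

    Found : ℕ → Set
    Found y = Σ ℕ λ u → Stack u × Parent u y

    -- nothing is popped below the bottom #, since # ⋖ everything
    bottom-no-rest : ∀ {y} → ¬ RestAt 0 y
    bottom-no-rest (stopAt _ ())
    bottom-no-rest (stepAt _ () _)

    compare : ∀ {t y} → Stack t → GapAt t y → y ≤ suc n → Defined M (P t) (P y) → Found y
    pop : ∀ {t y} → Stack t → RestAt t y → y ≤ suc n → Found y
    compare st g _ (⋖ , lt) = _ , st , g , inj₁ lt
    compare st g _ (≐ , eq) = _ , st , g , inj₂ eq
    compare st g b (⋗ , gt) = pop st (stopAt g gt) b
    pop bottom r _ = ⊥-elim (bottom-no-rest r)
    pop {y = y} (push {u = u} st (g , inj₁ lt)) r b =
      compare st (nestedAt c) b
        (proj₂ compatible u y (<⇒≤ (<-trans (n<1+n u) (chainAt-< c))) b (chainAt⇒sub c b))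
      where c = chainAt lt g r
    pop (push st (g , inj₂ eq)) r b = pop st (stepAt g eq r) b

    -- consecutive positions are related: by compatibility inside the word,
    -- and by the conventions for # at its ends
    adjacent-defined : ∀ j → suc j ≤ suc n → Defined M (P j) (P (suc j))
    adjacent-defined zero _ = ⋖ , #⋖
    adjacent-defined (suc k) b = by-cases (suc (suc k) ≤? n)
      where
      by-cases : Dec (suc (suc k) ≤ n) → Defined M (P (suc k)) (P (suc (suc k)))
      by-cases (yes inside-word) = proj₁ compatible (suc k) (s≤s z≤n) inside-word
      by-cases (no ¬inside-word) with ≤-antisym (≤-pred b) (≮⇒≥ ¬inside-word)
      ... | refl with P-letter (suc k) (s≤s z≤n) ≤-refl
      ...   | _ , P≡ = subst₂ (Defined M) (sym P≡) (sym P-end) (⋗ , ⋗#)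

    stack-at     : ∀ j → j ≤ suc n → Stack j
    parent-found : ∀ j → suc j ≤ suc n → Found (suc j)
    stack-at zero    _ = bottom
    stack-at (suc j) b with parent-found j b
    ... | _ , st , par = push st par
    parent-found j b = compare (stack-at j (≤-trans (n≤1+n j) b)) adjacent b (adjacent-defined j b)

    τ-total : ∀ y → y ≤ suc n → ∃ (Tau y)
    τ-total = <-rec (λ y → y ≤ suc n → ∃ (Tau y)) node-of
      where
      node-of : ∀ y → (∀ {u} → u < y → u ≤ suc n → ∃ (Tau u)) → y ≤ suc n → ∃ (Tau y)
      node-of zero    _       _ = _ , root
      node-of (suc j) earlier b with parent-found j b
      ... | _ , _ , par with earlier (gapAt-< (proj₁ par)) (≤-trans (<⇒≤ (gapAt-< (proj₁ par))) b)
      ...   | _ , t = node-below-parent par b t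

lemma1 : ∀ {m} (M : OPM m) (n : ℕ) (x : Fin n → Letter m) →
    Word.Compatible M n x →
    -- every position of w gets exactly one node
    (∀ i → i ≤ suc n →
      ∃ λ (s : List ℕ) → Word.Tau M n x i s × (∀ s′ → Word.Tau M n x i s′ → s′ ≡ s)) ×
    -- τ assigns nodes only to positions of w
    (∀ i s → Word.Tau M n x i s → i ≤ suc n) ×
    -- τ is injective (hence a bijection from U onto the node set of T_w)
    (∀ i j s → Word.Tau M n x i s → Word.Tau M n x j s → i ≡ j)
lemma1 M n x compatible =
  (λ i i≤ → let (s , t) = τ-total i i≤ in s , t , λ _ t′ → τ-functional t′ t) ,
  (λ _ _ → τ-bounded) ,
  (λ _ _ _ t t′ → τ-injective t t′ refl)
  where
  open Positions M n x
  open Parsing compatible
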